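{- Let $n$ be a positive integer and let $\mathcal{F}=\{F_1,\ldots,F_m\}$ be a family of $m$ distinct subsets of $[n]=\{1,2,\ldots,n\}$. Suppose there exists a positive integer $\lambda>0$ such that $|F_i \,\Delta\, F_j|=\lambda$ for all $i\neq j$, where $\Delta$ denotes symmetric difference. Suppose further that $\lambda\neq \frac{n+1}{2}$. Then $m=|\mathcal{F}|\leq n$.
   Context: For sets $F,G\subseteq[n]$, the Hamming distance is $d_H(F,G)=|F\,\Delta\, G|$, the size of their symmetric difference. -}

module Defs where

open import Data.Nat using (ℕ)
open import Data.Fin.Subset using (Subset; _∪_; _─_; ∣_∣)

_Δ_ : ∀ {n} → Subset n → Subset n → Subset n
F Δ G = (F ─ G) ∪ (G ─ F)

dH : ∀ {n} → Subset n → Subset n → ℕ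
dH F G = ∣ F Δ G ∣

{-# OPTIONS --safe #-}
-- Fix G₀. The vectors χ(Gⱼ Δ G₀), 1 ≤ j ≤ n, together with the all-ones vector 1 are
-- n + 1 vectors in ℤⁿ, so a nontrivial integer combination of them vanishes. Their inner
-- products are fixed by the distances: 1·1 = n, 1·χⱼ = λ, and by polarisation
-- 2 χᵢ·χⱼ = d(Gᵢ,G₀) + d(Gⱼ,G₀) − d(Gᵢ,Gⱼ), which is λ for i ≠ j and 2λ for i = j.
-- Pairing the vanishing combination with each of the vectors gives a linear system whose
-- only solution is zero unless 2λ = n + 1, so n + 1 sets at pairwise distance λ cannot exist.
module Submission where

module IntegerVectors where

  open import Data.Fin using (Fin; zero; suc; punchIn)
  open import Data.Fin.Properties using (all?; ¬∀⟶∃¬; punchInᵢ≢i)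
  open import Data.Integer using (ℤ; 0ℤ; 1ℤ; +_; -_; _+_; _-_; _*_; _≟_)
  open import Data.Integer.Properties
    using ( +-*-semiring; *-zeroʳ; *-comm; *-assoc; +-inverseʳ
          ; neg-distribˡ-*; neg-distribʳ-*; i*j≡0⇒i≡0∨j≡0)
  open import Data.Integer.Tactic.RingSolver using (solve-∀)
  open import Data.Nat using (zero; suc; _<_; s≤s)
  open import Data.Nat.Properties using (m≤n⇒m≤1+n)
  open import Data.Product using (∃; _×_; _,_)
  open import Data.Sum using ([_,_]′)
  open import Data.Vec.Functional using (Vector; tail; insertAt; removeAt)
  open import Data.Vec.Functional.Properties using (insertAt-lookup; insertAt-punchIn)
  open import Function using (_∘_; id; flip)
  open import Relation.Binary.PropositionalEquality
  open import Relation.Nullary using (yes; no; contradiction)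
  open import Algebra.Properties.Semiring.Sum +-*-semiring
  open ≡-Reasoning

  i≢0⇒i*j≡0⇒j≡0 : ∀ {i j} → i ≢ 0ℤ → i * j ≡ 0ℤ → j ≡ 0ℤ
  i≢0⇒i*j≡0⇒j≡0 i≢0 i*j≡0 =
    [ flip contradiction i≢0 , id ]′ (i*j≡0⇒i≡0∨j≡0 _ i*j≡0)

  sum-zero : ∀ {n} {f : Vector ℤ n} → (∀ i → f i ≡ 0ℤ) → sum f ≡ 0ℤ
  sum-zero {n} f≡0 = trans (sum-cong-≗ f≡0) (sum-replicate-zero n)

  sum-const : ∀ n x → ∑[ i < n ] x ≡ + n * x
  sum-const zero    x = refl
  sum-const (suc n) x = trans (cong (_+_ x) (sum-const n x)) (distrib x (+ n))
    where
    distrib : ∀ x m → x + m * x ≡ (1ℤ + m) * x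
    distrib = solve-∀

  ∑-spike : ∀ {n} (c e : Vector ℤ n) (j : Fin n) {α β} →
            (∀ i → i ≢ j → e i ≡ α) → e j ≡ β →
            ∑[ i < n ] (c i * e i) ≡ α * sum c + (β - α) * c j
  ∑-spike {suc n} c e j {α} {β} e≡α e≡β = begin
    ∑[ i < suc n ] (c i * e i)
      ≡⟨ sum-remove {i = j} (λ i → c i * e i) ⟩
    c j * e j + ∑[ i < n ] (removeAt c j i * removeAt e j i)
      ≡⟨ cong₂ _+_ (cong (c j *_) e≡β)
                   (sum-cong-≗ (λ i → cong (removeAt c j i *_) (e≡α _ (punchInᵢ≢i j i)))) ⟩
    c j * β + ∑[ i < n ] (removeAt c j i * α)
      ≡⟨ cong (_+_ (c j * β)) (sym (*-distribʳ-sum α (removeAt c j))) ⟩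
    c j * β + sum (removeAt c j) * α
      ≡⟨ regroup (c j) (sum (removeAt c j)) α β ⟩
    α * (c j + sum (removeAt c j)) + (β - α) * c j
      ≡⟨ cong (λ s → α * s + (β - α) * c j) (sym (sum-remove c)) ⟩
    α * sum c + (β - α) * c j ∎
    where
    regroup : ∀ x s α β → x * β + s * α ≡ α * (x + s) + (β - α) * x
    regroup = solve-∀

  _∙_ : ∀ {n} → Vector ℤ n → Vector ℤ n → ℤ
  u ∙ v = ∑[ t < _ ] (u t * v t)

  IsRelation : ∀ {k n} → (Fin k → Vector ℤ n) → Vector ℤ k → Set
  IsRelation {k} v c = ∀ t → ∑[ i < k ] (c i * v i t) ≡ 0ℤ

  LinearlyDependent : ∀ {k n} → (Fin k → Vector ℤ n) → Set
  LinearlyDependent v = ∃ λ c → (∃ λ i → c i ≢ 0ℤ) × IsRelation v c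

  relation-∙ : ∀ {k n} (v : Fin k → Vector ℤ n) c → IsRelation v c →
               ∀ w → ∑[ i < k ] (c i * (v i ∙ w)) ≡ 0ℤ
  relation-∙ {k} {n} v c rel w = begin
    ∑[ i < k ] (c i * (v i ∙ w))
      ≡⟨ sum-cong-≗ (λ i → *-distribˡ-sum (c i) (λ t → v i t * w t)) ⟩
    ∑[ i < k ] ∑[ t < n ] (c i * (v i t * w t))
      ≡⟨ ∑-comm (λ i t → c i * (v i t * w t)) ⟩
    ∑[ t < n ] ∑[ i < k ] (c i * (v i t * w t))
      ≡⟨ sum-cong-≗ (λ t → sym (trans (*-distribʳ-sum (w t) (λ i → c i * v i t))
                                      (sum-cong-≗ (λ i → *-assoc (c i) (v i t) (w t))))) ⟩
    ∑[ t < n ] (∑[ i < k ] (c i * v i t) * w t)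
      ≡⟨ sum-zero (λ t → cong (_* w t) (rel t)) ⟩
    0ℤ ∎

  -- Fraction-free elimination of the first coordinate with pivot row p: a relation
  -- among the k reduced rows lifts to one among the k + 1 original rows.
  module _ {k n} (v : Fin (suc k) → Vector ℤ (suc n)) (p : Fin (suc k)) where

    private
      a : ℤ
      a = v p zero

      r : Fin k → Vector ℤ (suc n)
      r = removeAt v p

    eliminate : Fin k → Vector ℤ n
    eliminate j t = a * r j (suc t) - r j zero * v p (suc t)

    lift : Vector ℤ k → Vector ℤ (suc k)
    lift c = insertAt (λ j → a * c j) p (- ∑[ j < k ] (c j * r j zero))

    lift-combination : ∀ c t → ∑[ i < suc k ] (lift c i * v i t) ≡
                               ∑[ j < k ] (c j * (a * r j t - r j zero * v p t))
    lift-combination c t = begin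
      ∑[ i < suc k ] (lift c i * v i t)
        ≡⟨ sum-remove {i = p} (λ i → lift c i * v i t) ⟩
      lift c p * v p t + ∑[ j < k ] (lift c (punchIn p j) * r j t)
        ≡⟨ cong₂ _+_ (cong (_* v p t) (insertAt-lookup _ p _))
                     (sum-cong-≗ (λ j → cong (_* r j t) (insertAt-punchIn _ p _ j))) ⟩
      - X * v p t + Y
        ≡⟨ cong (_+ Y) (trans (sym (neg-distribˡ-* X (v p t))) (neg-distribʳ-* X (v p t))) ⟩
      X * - v p t + Y
        ≡⟨ cong (_+ Y) (*-distribʳ-sum (- v p t) (λ j → c j * r j zero)) ⟩
      ∑[ j < k ] (c j * r j zero * - v p t) + Y
        ≡⟨ sym (∑-distrib-+ (λ j → c j * r j zero * - v p t) (λ j → a * c j * r j t)) ⟩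
      ∑[ j < k ] (c j * r j zero * - v p t + a * c j * r j t)
        ≡⟨ sum-cong-≗ (λ j → factor a (c j) (r j zero) (v p t) (r j t)) ⟩
      ∑[ j < k ] (c j * (a * r j t - r j zero * v p t)) ∎
      where
      X Y : ℤ
      X = ∑[ j < k ] (c j * r j zero)
      Y = ∑[ j < k ] (a * c j * r j t)
      factor : ∀ a x y z w → x * y * - z + a * x * w ≡ x * (a * w - y * z)
      factor = solve-∀

    lift-relation : ∀ {c} → IsRelation eliminate c → IsRelation v (lift c)
    lift-relation {c} _ zero = trans (lift-combination c zero) (sum-zero pivot-column-vanishes)
      where
      pivot-column-vanishes : ∀ j → c j * (a * r j zero - r j zero * a) ≡ 0ℤ
      pivot-column-vanishes j = begin
        c j * (a * r j zero - r j zero * a)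
          ≡⟨ cong (λ x → c j * (a * r j zero - x)) (*-comm (r j zero) a) ⟩
        c j * (a * r j zero - a * r j zero)
          ≡⟨ cong (c j *_) (+-inverseʳ (a * r j zero)) ⟩
        c j * 0ℤ
          ≡⟨ *-zeroʳ (c j) ⟩
        0ℤ ∎
    lift-relation {c} rel (suc t) = trans (lift-combination c (suc t)) (rel t)

    lift-nonzero : a ≢ 0ℤ → ∀ {c j} → c j ≢ 0ℤ → lift c (punchIn p j) ≢ 0ℤ
    lift-nonzero a≢0 cⱼ≢0 liftⱼ≡0 =
      cⱼ≢0 (i≢0⇒i*j≡0⇒j≡0 a≢0 (trans (sym (insertAt-punchIn _ p _ _)) liftⱼ≡0))

  dependent-by-elimination : ∀ {k n} (v : Fin (suc k) → Vector ℤ (suc n)) p →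
                             v p zero ≢ 0ℤ → LinearlyDependent (eliminate v p) →
                             LinearlyDependent v
  dependent-by-elimination v p a≢0 (c , (j , cⱼ≢0) , rel) =
    lift v p c , (punchIn p j , lift-nonzero v p a≢0 cⱼ≢0) , lift-relation v p rel

  dependent-by-zero-column : ∀ {k n} (v : Fin k → Vector ℤ (suc n)) →
                             (∀ i → v i zero ≡ 0ℤ) → LinearlyDependent (tail ∘ v) →
                             LinearlyDependent v
  dependent-by-zero-column v column≡0 (c , nontrivial , rel) = c , nontrivial , rel′
    where
    rel′ : IsRelation v c
    rel′ zero    = sum-zero (λ i → trans (cong (c i *_) (column≡0 i)) (*-zeroʳ (c i)))
    rel′ (suc t) = rel t

  linearlyDependent : ∀ {k n} → n < k → (v : Fin k → Vector ℤ n) → LinearlyDependent v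
  linearlyDependent {suc k} {zero}  _         v = (λ _ → 1ℤ) , (zero , λ ()) , λ ()
  linearlyDependent {suc k} {suc n} (s≤s n<k) v with all? (λ i → v i zero ≟ 0ℤ)
  ... | yes column≡0 =
    dependent-by-zero-column v column≡0 (linearlyDependent (m≤n⇒m≤1+n n<k) (tail ∘ v))
  ... | no column≢0 with ¬∀⟶∃¬ _ _ (λ i → v i zero ≟ 0ℤ) column≢0
  ...   | p , a≢0 = dependent-by-elimination v p a≢0 (linearlyDependent n<k (eliminate v p))

module EquidistantSets where

  open IntegerVectors
  open import Data.Integer.Properties
    using ( +-*-semiring; +-0-abelianGroup; +-injective; pos-*; *-distribˡ-+
          ; *-identityˡ; *-identityʳ; *-zeroʳ; +-inverseʳ; i-j≡0⇒i≡j)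
  open import Algebra.Properties.AbelianGroup +-0-abelianGroup using (inverseʳ-unique; ∙-cancelʳ)
  open import Algebra.Properties.Semiring.Sum +-*-semiring
    using (sum; sum-syntax; sum-cong-≗; ∑-distrib-+; *-distribˡ-sum; *-distribʳ-sum)
  open import Data.Bool using (Bool; true; false; _xor_)
  open import Data.Fin using (Fin; zero; suc)
  open import Data.Fin.Properties using (suc-injective)
  open import Data.Fin.Subset using (Subset; ∣_∣)
  open import Data.Integer using (ℤ; 0ℤ; 1ℤ; +_; -_; _+_; _-_; _*_)
  open import Data.Integer.Tactic.RingSolver using (solve-∀)
  import Data.Nat as ℕ
  open import Data.Nat using (suc; _≤_; _<_)
  open import Data.Nat.Properties using (<⇒≢; n<1+n)
  open import Data.Product using (_×_; _,_; proj₁; proj₂)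
  open import Data.Vec using ([]; _∷_; lookup)
  open import Data.Vec.Functional using (Vector)
  open import Function using (_∘_)
  open import Relation.Binary.PropositionalEquality
  open import Relation.Nullary using (¬_)
  open import Defs
  open ≡-Reasoning

  𝟙 : Bool → ℤ
  𝟙 true  = 1ℤ
  𝟙 false = 0ℤ

  𝟙-idem : ∀ b → 𝟙 b * 𝟙 b ≡ 𝟙 b
  𝟙-idem true  = refl
  𝟙-idem false = refl

  𝟙-xor-polarisation : ∀ x y z → + 2 * (𝟙 (x xor z) * 𝟙 (y xor z)) + 𝟙 (x xor y) ≡
                                 𝟙 (x xor z) + 𝟙 (y xor z)
  𝟙-xor-polarisation true  true  true  = refl
  𝟙-xor-polarisation true  true  false = refl
  𝟙-xor-polarisation true  false true  = refl
  𝟙-xor-polarisation true  false false = refl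
  𝟙-xor-polarisation false true  true  = refl
  𝟙-xor-polarisation false true  false = refl
  𝟙-xor-polarisation false false true  = refl
  𝟙-xor-polarisation false false false = refl

  χ : ∀ {n} → Subset n → Vector ℤ n
  χ S t = 𝟙 (lookup S t)

  1ᵛ : ∀ {n} → Vector ℤ n
  1ᵛ _ = 1ℤ

  χ-Δ : ∀ {n} (F G : Subset n) t → χ (F Δ G) t ≡ 𝟙 (lookup F t xor lookup G t)
  χ-Δ (true  ∷ F) (true  ∷ G) zero    = refl
  χ-Δ (true  ∷ F) (false ∷ G) zero    = refl
  χ-Δ (false ∷ F) (true  ∷ G) zero    = refl
  χ-Δ (false ∷ F) (false ∷ G) zero    = refl
  χ-Δ (_     ∷ F) (_     ∷ G) (suc t) = χ-Δ F G t

  sum-χ : ∀ {n} (S : Subset n) → sum (χ S) ≡ + ∣ S ∣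
  sum-χ []          = refl
  sum-χ (true  ∷ S) = cong (_+_ 1ℤ) (sum-χ S)
  sum-χ (false ∷ S) = cong (_+_ 0ℤ) (sum-χ S)

  1ᵛ-∙-1ᵛ : ∀ n → 1ᵛ {n} ∙ 1ᵛ ≡ + n
  1ᵛ-∙-1ᵛ n = trans (sum-const n 1ℤ) (*-identityʳ (+ n))

  χ-∙-1ᵛ : ∀ {n} (S : Subset n) → χ S ∙ 1ᵛ ≡ + ∣ S ∣
  χ-∙-1ᵛ S = trans (sum-cong-≗ (λ t → *-identityʳ (χ S t))) (sum-χ S)

  1ᵛ-∙-χ : ∀ {n} (S : Subset n) → 1ᵛ ∙ χ S ≡ + ∣ S ∣
  1ᵛ-∙-χ S = trans (sum-cong-≗ (λ t → *-identityˡ (χ S t))) (sum-χ S)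

  χ-∙-χ : ∀ {n} (S : Subset n) → χ S ∙ χ S ≡ + ∣ S ∣
  χ-∙-χ S = trans (sum-cong-≗ (λ t → 𝟙-idem (lookup S t))) (sum-χ S)

  χΔ-polarisation : ∀ {n} (F G H : Subset n) →
                    + 2 * (χ (F Δ H) ∙ χ (G Δ H)) + + dH F G ≡ + dH F H + + dH G H
  χΔ-polarisation {n} F G H = begin
    + 2 * (f ∙ g) + + dH F G             ≡⟨ cong₂ _+_ (*-distribˡ-sum (+ 2) (λ t → f t * g t))
                                                      (sym (sum-χ (F Δ G))) ⟩
    ∑[ t < n ] (+ 2 * (f t * g t)) + sum d ≡⟨ sym (∑-distrib-+ (λ t → + 2 * (f t * g t)) d) ⟩
    ∑[ t < n ] (+ 2 * (f t * g t) + d t) ≡⟨ sum-cong-≗ pointwise ⟩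
    ∑[ t < n ] (f t + g t)               ≡⟨ ∑-distrib-+ f g ⟩
    sum f + sum g                        ≡⟨ cong₂ _+_ (sum-χ (F Δ H)) (sum-χ (G Δ H)) ⟩
    + dH F H + + dH G H                  ∎
    where
    f g d : Vector ℤ n
    f = χ (F Δ H)
    g = χ (G Δ H)
    d = χ (F Δ G)

    pointwise : ∀ t → + 2 * (f t * g t) + d t ≡ f t + g t
    pointwise t rewrite χ-Δ F H t | χ-Δ G H t | χ-Δ F G t =
      𝟙-xor-polarisation (lookup F t) (lookup G t) (lookup H t)

  gram-system-trivial : ∀ {n} λ′ → 1 ≤ n → 2 ℕ.* λ′ ≢ suc n →
                        ∀ c₀ (c : Vector ℤ n) →
                        c₀ * + n + sum c * + λ′ ≡ 0ℤ →
                        (∀ j → + 2 * c₀ + sum c + c j ≡ 0ℤ) →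
                        c₀ ≡ 0ℤ × (∀ j → c j ≡ 0ℤ)
  gram-system-trivial {n} λ′ n≥1 2λ′≢1+n c₀ c row₀ row = c₀≡0 , c≡0
    where
    -- Each row j says c j = - T, which collapses the system to two equations in c₀ and T.
    T : ℤ
    T = + 2 * c₀ + sum c

    c≡-T : ∀ j → c j ≡ - T
    c≡-T j = inverseʳ-unique T (c j) (row j)

    sum≡n*-T : sum c ≡ + n * - T
    sum≡n*-T = trans (sum-cong-≗ c≡-T) (sum-const n (- T))

    n≢0 : + n ≢ 0ℤ
    n≢0 n≡0 = <⇒≢ n≥1 (sym (+-injective n≡0))

    2λ′-1-n≢0 : + 2 * + λ′ - + suc n ≢ 0ℤ
    2λ′-1-n≢0 e =
      2λ′≢1+n (+-injective (trans (pos-* 2 λ′) (i-j≡0⇒i≡j (+ 2 * + λ′) (+ suc n) e)))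

    c₀≡λ′T : c₀ ≡ + λ′ * T
    c₀≡λ′T = i-j≡0⇒i≡j c₀ (+ λ′ * T) (i≢0⇒i*j≡0⇒j≡0 n≢0 (begin
      + n * (c₀ - + λ′ * T)         ≡⟨ expand (+ n) c₀ (+ λ′) T ⟩
      c₀ * + n + + n * - T * + λ′   ≡⟨ cong (λ s → c₀ * + n + s * + λ′) (sym sum≡n*-T) ⟩
      c₀ * + n + sum c * + λ′       ≡⟨ row₀ ⟩
      0ℤ                            ∎))
      where
      expand : ∀ N c L T → N * (c - L * T) ≡ c * N + N * - T * L
      expand = solve-∀

    T≡0 : T ≡ 0ℤ
    T≡0 = i≢0⇒i*j≡0⇒j≡0 2λ′-1-n≢0 (begin
      (+ 2 * + λ′ - + suc n) * T
        ≡⟨ expand (+ λ′) (+ n) T ⟩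
      + 2 * (+ λ′ * T) + + n * - T - T
        ≡⟨ cong₂ (λ x s → + 2 * x + s - T) (sym c₀≡λ′T) (sym sum≡n*-T) ⟩
      T - T
        ≡⟨ +-inverseʳ T ⟩
      0ℤ ∎)
      where
      expand : ∀ L N T → (+ 2 * L - (1ℤ + N)) * T ≡ + 2 * (L * T) + N * - T - T
      expand = solve-∀

    c₀≡0 : c₀ ≡ 0ℤ
    c₀≡0 = trans c₀≡λ′T (trans (cong (+ λ′ *_) T≡0) (*-zeroʳ (+ λ′)))

    c≡0 : ∀ j → c j ≡ 0ℤ
    c≡0 j = trans (c≡-T j) (cong -_ T≡0)

  module _ {n λ′} (G : Fin (suc n) → Subset n)
           (equidistant : ∀ i j → i ≢ j → dH (G i) (G j) ≡ λ′) where

    u : Fin (suc n) → Vector ℤ n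
    u zero    = 1ᵛ
    u (suc j) = χ (G (suc j) Δ G zero)

    u-∙-1ᵛ : ∀ j → u (suc j) ∙ 1ᵛ ≡ + λ′
    u-∙-1ᵛ j = trans (χ-∙-1ᵛ (G (suc j) Δ G zero)) (cong +_ (equidistant (suc j) zero λ ()))

    1ᵛ-∙-u : ∀ j → 1ᵛ ∙ u (suc j) ≡ + λ′
    1ᵛ-∙-u j = trans (1ᵛ-∙-χ (G (suc j) Δ G zero)) (cong +_ (equidistant (suc j) zero λ ()))

    u-∙-u-self : ∀ j → u (suc j) ∙ u (suc j) ≡ + λ′
    u-∙-u-self j = trans (χ-∙-χ (G (suc j) Δ G zero)) (cong +_ (equidistant (suc j) zero λ ()))

    u-∙-u-distinct : ∀ i j → i ≢ j → + 2 * (u (suc i) ∙ u (suc j)) ≡ + λ′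
    u-∙-u-distinct i j i≢j = ∙-cancelʳ (+ λ′) _ _ (begin
      + 2 * (u (suc i) ∙ u (suc j)) + + λ′
        ≡⟨ cong (λ d → + 2 * (u (suc i) ∙ u (suc j)) + + d)
                (sym (equidistant (suc i) (suc j) (i≢j ∘ suc-injective))) ⟩
      + 2 * (u (suc i) ∙ u (suc j)) + + dH (G (suc i)) (G (suc j))
        ≡⟨ χΔ-polarisation (G (suc i)) (G (suc j)) (G zero) ⟩
      + dH (G (suc i)) (G zero) + + dH (G (suc j)) (G zero)
        ≡⟨ cong₂ (λ x y → + x + + y) (equidistant (suc i) zero λ ())
                                      (equidistant (suc j) zero λ ()) ⟩
      + λ′ + + λ′ ∎)

    relation-against-1ᵛ : ∀ c → IsRelation u c → c zero * + n + sum (c ∘ suc) * + λ′ ≡ 0ℤ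
    relation-against-1ᵛ c rel = begin
      c zero * + n + sum (c ∘ suc) * + λ′
        ≡⟨ cong₂ _+_ (cong (c zero *_) (sym (1ᵛ-∙-1ᵛ n)))
                     (*-distribʳ-sum (+ λ′) (c ∘ suc)) ⟩
      c zero * (u zero ∙ 1ᵛ) + ∑[ j < n ] (c (suc j) * + λ′)
        ≡⟨ cong (_+_ (c zero * (u zero ∙ 1ᵛ)))
                (sum-cong-≗ (λ j → cong (c (suc j) *_) (sym (u-∙-1ᵛ j)))) ⟩
      ∑[ i < suc n ] (c i * (u i ∙ 1ᵛ))
        ≡⟨ relation-∙ u c rel 1ᵛ ⟩
      0ℤ ∎

    relation-against-u : ∀ c → IsRelation u c →
                         ∀ j → + λ′ * (+ 2 * c zero + sum (c ∘ suc) + c (suc j)) ≡ 0ℤ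
    relation-against-u c rel j = begin
      + λ′ * (+ 2 * c₀ + sum c′ + c′ j)
        ≡⟨ regroup (+ λ′) c₀ (sum c′) (c′ j) ⟩
      + 2 * (c₀ * + λ′) + (+ λ′ * sum c′ + (+ 2 * + λ′ - + λ′) * c′ j)
        ≡⟨ cong₂ _+_ (cong (λ x → + 2 * (c₀ * x)) (sym (1ᵛ-∙-u j)))
                     (sym (∑-spike c′ (λ i → + 2 * g i) j (λ i → u-∙-u-distinct i j)
                                   (cong (+ 2 *_) (u-∙-u-self j)))) ⟩
      + 2 * (c₀ * g₀) + ∑[ i < n ] (c′ i * (+ 2 * g i))
        ≡⟨ cong (_+_ (+ 2 * (c₀ * g₀))) (sum-cong-≗ (λ i → pull-out-2 (c′ i) (g i))) ⟩
      + 2 * (c₀ * g₀) + ∑[ i < n ] (+ 2 * (c′ i * g i))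
        ≡⟨ cong (_+_ (+ 2 * (c₀ * g₀))) (sym (*-distribˡ-sum (+ 2) (λ i → c′ i * g i))) ⟩
      + 2 * (c₀ * g₀) + + 2 * ∑[ i < n ] (c′ i * g i)
        ≡⟨ sym (*-distribˡ-+ (+ 2) (c₀ * g₀) (∑[ i < n ] (c′ i * g i))) ⟩
      + 2 * ∑[ i < suc n ] (c i * (u i ∙ u (suc j)))
        ≡⟨ cong (+ 2 *_) (relation-∙ u c rel (u (suc j))) ⟩
      0ℤ ∎
      where
      c₀ g₀ : ℤ
      c₀ = c zero
      g₀ = u zero ∙ u (suc j)

      c′ g : Vector ℤ n
      c′ = c ∘ suc
      g i = u (suc i) ∙ u (suc j)

      regroup : ∀ L c₀ S x → L * (+ 2 * c₀ + S + x) ≡ + 2 * (c₀ * L) + (L * S + (+ 2 * L - L) * x)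
      regroup = solve-∀
      pull-out-2 : ∀ x d → x * (+ 2 * d) ≡ + 2 * (x * d)
      pull-out-2 = solve-∀

  no-equidistant-family : ∀ {n λ′} → 1 ≤ n → 0 < λ′ → 2 ℕ.* λ′ ≢ suc n →
                          (G : Fin (suc n) → Subset n) →
                          ¬ (∀ i j → i ≢ j → dH (G i) (G j) ≡ λ′)
  no-equidistant-family {n} {λ′} n≥1 λ′>0 2λ′≢1+n G equidistant
    with linearlyDependent (n<1+n n) (u G equidistant)
  ... | c , (i , cᵢ≢0) , rel = cᵢ≢0 (c≡0 i)
    where
    λ′≢0 : + λ′ ≢ 0ℤ
    λ′≢0 λ′≡0 = <⇒≢ λ′>0 (sym (+-injective λ′≡0))

    solution : c zero ≡ 0ℤ × (∀ j → c (suc j) ≡ 0ℤ)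
    solution = gram-system-trivial λ′ n≥1 2λ′≢1+n (c zero) (c ∘ suc)
      (relation-against-1ᵛ G equidistant c rel)
      (λ j → i≢0⇒i*j≡0⇒j≡0 λ′≢0 (relation-against-u G equidistant c rel j))

    c≡0 : ∀ i → c i ≡ 0ℤ
    c≡0 zero    = proj₁ solution
    c≡0 (suc j) = proj₂ solution j

open EquidistantSets using (no-equidistant-family)

open import Data.Fin using (Fin; inject≤)
open import Data.Fin.Properties using (inject≤-injective)
open import Data.Fin.Subset using (Subset)
open import Data.Nat using (ℕ; suc; _*_; _≤_; _<_; _≤?_)
open import Data.Nat.Properties using (≰⇒>)
open import Function using (_∘_)
open import Function.Definitions using (Injective)
open import Relation.Binary.PropositionalEquality using (_≡_; _≢_)
open import Relation.Nullary using (yes; no; contradiction)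
open import Defs

theorem3 : (n m λ′ : ℕ) → 1 ≤ n → (F : Fin m → Subset n) →
    Injective _≡_ _≡_ F →
    0 < λ′ →
    (∀ i j → i ≢ j → dH (F i) (F j) ≡ λ′) →
    2 * λ′ ≢ suc n →
    m ≤ n
theorem3 n m λ′ n≥1 F _ λ′>0 equidistant 2λ′≢1+n with m ≤? n
... | yes m≤n = m≤n
... | no m≰n = contradiction equidistant′ (no-equidistant-family n≥1 λ′>0 2λ′≢1+n G)
  where
  n<m : suc n ≤ m
  n<m = ≰⇒> m≰n

  G : Fin (suc n) → Subset n
  G i = F (inject≤ i n<m)

  equidistant′ : ∀ i j → i ≢ j → dH (G i) (G j) ≡ λ′
  equidistant′ i j i≢j = equidistant _ _ (i≢j ∘ inject≤-injective n<m n<m i j)
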